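{- If $\mathcal X$ and $\mathcal Y$ are unsplittable permutation classes, then $\mathcal X[\mathcal Y]$ is unsplittable.
   Context: $\mathcal X[\mathcal Y]$ is the set of all inflations $\sigma[\tau_1,\dots,\tau_k]$ with $\sigma\in\mathcal X$ of size $k$ and $\tau_i\in\mathcal Y$ (each point $\sigma_i$ replaced by an interval order-isomorphic to $\tau_i$). A merge of permutations $\sigma,\tau$ is a permutation whose elements can be partitioned into a set with pattern $\sigma$ and a set with pattern $\tau$; for classes, $\mathcal C\odot\mathcal D$ is the set of merges of an element of $\mathcal C$ with one of $\mathcal D$. A class $\mathcal C$ is splittable if $\mathcal C\subseteq\mathcal C_1\odot\cdots\odot\mathcal C_k$ for finitely many proper subclasses $\mathcal C_i$ of $\mathcal C$; otherwise unsplittable. -}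

module Defs where

open import Data.Nat using (ℕ)
open import Data.Fin using (Fin; _<_; _≤_)
open import Data.Product using (Σ; Σ-syntax; _×_)
open import Data.Sum using (_⊎_)
open import Data.List using (List; []; _∷_)
open import Data.List.Relation.Unary.All using (All)
open import Relation.Nullary using (¬_)
open import Relation.Binary.PropositionalEquality using (_≡_; _≢_)
open import Function.Definitions using (Injective)
open import Function.Bundles using (_⇔_)

-- A permutation of size n: an injective (hence bijective) map Fin n → Fin n,
-- read as the sequence fun 0, fun 1, ..., fun (n-1).
record Perm : Set where
  constructor perm
  field
    size : ℕ
    fun  : Fin size → Fin size
    inj  : Injective _≡_ _≡_ fun
open Perm public

Occurrence : (σ π : Perm) → (Fin (size σ) → Fin (size π)) → Set
Occurrence σ π e =
  (∀ i j → i < j → e i < e j) ×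
  (∀ i j → (fun σ i < fun σ j) ⇔ (fun π (e i) < fun π (e j)))

_≼_ : Perm → Perm → Set
σ ≼ π = Σ[ e ∈ (Fin (size σ) → Fin (size π)) ] Occurrence σ π e

PermSet : Set₁
PermSet = Perm → Set

record Class : Set₁ where
  field
    mem    : PermSet
    closed : ∀ π σ → mem π → σ ≼ π → mem σ
open Class public

_⊆_ : PermSet → PermSet → Set
P ⊆ Q = ∀ π → P π → Q π

ProperSubclass : Class → PermSet → Set
ProperSubclass D P = (mem D ⊆ P) × (Σ[ π ∈ Perm ] (P π × ¬ mem D π))

IsMerge : (π σ τ : Perm) → Set
IsMerge π σ τ =
  Σ[ e₁ ∈ (Fin (size σ) → Fin (size π)) ] Σ[ e₂ ∈ (Fin (size τ) → Fin (size π)) ]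
    Occurrence σ π e₁ × Occurrence τ π e₂ ×
    (∀ x → (Σ[ i ∈ Fin (size σ) ] e₁ i ≡ x) ⊎ (Σ[ j ∈ Fin (size τ) ] e₂ j ≡ x)) ×
    (∀ i j → e₁ i ≢ e₂ j)

_⊙_ : PermSet → PermSet → PermSet
(P ⊙ Q) π = Σ[ σ ∈ Perm ] Σ[ τ ∈ Perm ] P σ × Q τ × IsMerge π σ τ

-- C₁ ⊙ C₂ ⊙ ⋯ ⊙ Cₖ  (k ≥ 1), given as first class and list of the rest
MergeAll : Class → List Class → PermSet
MergeAll C []       = mem C
MergeAll C (D ∷ Ds) = mem C ⊙ MergeAll D Ds

Splittable : PermSet → Set₁
Splittable P =
  Σ[ C ∈ Class ] Σ[ Cs ∈ List Class ]
    ProperSubclass C P × All (λ D → ProperSubclass D P) Cs × (P ⊆ MergeAll C Cs)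

Unsplittable : PermSet → Set₁
Unsplittable P = ¬ Splittable P

-- π = σ[τ_1,…,τ_k]: the positions of π are partitioned into consecutive
-- blocks (b x = index of the block containing position x, monotone), entries in
-- distinct blocks compare as the corresponding entries of σ, and block a is
-- an interval order-isomorphic to τ a (via an occurrence whose image is exactly block a).
IsInflation : (π σ : Perm) → (Fin (size σ) → Perm) → Set
IsInflation π σ τ =
  Σ[ b ∈ (Fin (size π) → Fin (size σ)) ]
    (∀ x y → x ≤ y → b x ≤ b y) ×
    (∀ x y → b x ≢ b y → (fun π x < fun π y) ⇔ (fun σ (b x) < fun σ (b y))) ×
    (∀ a → Σ[ e ∈ (Fin (size (τ a)) → Fin (size π)) ]
             Occurrence (τ a) π e × (∀ x → (b x ≡ a) ⇔ (Σ[ i ∈ Fin (size (τ a)) ] e i ≡ x)))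

Inflations : Class → Class → PermSet
Inflations X Y π =
  Σ[ σ ∈ Perm ] Σ[ τ ∈ (Fin (size σ) → Perm) ]
    mem X σ × (∀ a → mem Y (τ a)) × IsInflation π σ τ

-- An unsplittable class C has a Ramsey property: for σ₀, …, σₖ ∈ C there is
-- ρ ∈ C such that every (k+1)-colouring of ρ contains some σ_c inside colour
-- class c; otherwise every member of C is coloured so that colour c avoids σ_c,
-- which splits C into the proper subclasses Av(σ_c). Unsplittable classes also
-- have the joint embedding property.
--
-- Now let C₀, …, Cₖ split X[Y], and pick π_c = σ_c[τ_c] ∈ X[Y] outside C_c.
-- Bound each family τ_c in Y by a single τ*_c ∈ Y, take ρ ∈ X Ramsey for the
-- σ_c and ρ′ ∈ Y Ramsey for the τ*_c, and colour ρ[ρ′, …, ρ′] ∈ X[Y] by the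
-- splitting. Each copy x of ρ′ has a colour d(x) containing τ*_{d(x)}; the
-- colouring x ↦ d(x) of ρ has a colour c containing σ_c, and over that copy of
-- σ_c the copies of τ*_c contain a copy of π_c in colour c, so π_c ∈ C_c.

module Submission where

open import Defs
open import Level using (0ℓ)
open import Data.Nat as ℕ using (ℕ; zero; suc)
import Data.Nat.Properties as ℕ
open import Data.Fin
  using (Fin; zero; suc; toℕ; _<_; _≤_; punchIn; punchOut; combine; quotient; remainder; finToFun; funToFin)
open import Data.Fin.Properties
  using ( <-cmp; <-irrefl; <-asym; <⇒≢; ≤∧≢⇒<; _<?_; _≟_; any?; all?; ¬∀⟶∃¬
        ; punchIn-injective; punchInᵢ≢i; punchIn-mono-≤; punchOut-injective; punchOut-mono-≤; punchIn-punchOut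
        ; toℕ-combine; combine-monoˡ-<; combine-injective; combine-remQuot; remQuot-combine; finToFun-funToFin )
open import Data.Product using (Σ; Σ-syntax; ∃; _×_; _,_; proj₁; proj₂; uncurry)
open import Data.Sum using (_⊎_; inj₁; inj₂; [_,_]′)
open import Data.Empty using (⊥; ⊥-elim)
open import Data.List using ([]; _∷_; length; lookup; tabulate)
import Data.List.Relation.Unary.All as All
import Data.List.Relation.Unary.All.Properties as All
open import Data.List.Membership.Propositional.Properties using (∈-lookup)
open import Relation.Nullary using (¬_; Dec; yes; no)
open import Relation.Nullary.Negation using (contradiction; ¬¬-Monad)
open import Relation.Nullary.Decidable using (map′; ¬?; _×-dec_; _→-dec_; decidable-stable)
open import Relation.Unary using (Decidable)
open import Relation.Binary using (Setoid; tri<; tri≈; tri>)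
import Relation.Binary.Reasoning.Setoid as SetoidReasoning
open import Relation.Binary.PropositionalEquality
  using (_≡_; _≢_; _≗_; refl; sym; trans; cong; cong₂; subst; subst₂; ≢-sym; module ≡-Reasoning)
open import Function using (_∘_; id)
open import Function.Definitions using (Injective)
open import Function.Bundles using (_⇔_; mk⇔; Equivalence)
open import Function.Properties.Equivalence using (⇔-setoid)
open import Effect.Monad using (RawMonad)

open Equivalence using (to; from)
open RawMonad (¬¬-Monad {a = 0ℓ}) using (_>>=_; pure)

module ⇔ = Setoid (⇔-setoid 0ℓ)
module ⇔-Reasoning = SetoidReasoning (⇔-setoid 0ℓ)

<-cong : ∀ {n} {i i′ j j′ : Fin n} → i ≡ i′ → j ≡ j′ → (i < j) ⇔ (i′ < j′)
<-cong refl refl = ⇔.refl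

StrictlyIncreasing : ∀ {m n} → (Fin m → Fin n) → Set
StrictlyIncreasing e = ∀ i j → i < j → e i < e j

module _ {m n} {e : Fin m → Fin n} (e-inc : StrictlyIncreasing e) where

  strictlyIncreasing-reflects-< : ∀ {i j} → e i < e j → i < j
  strictlyIncreasing-reflects-< {i} {j} ei<ej with <-cmp i j
  ... | tri< i<j _ _ = i<j
  ... | tri≈ _ refl _ = contradiction ei<ej (<-irrefl refl)
  ... | tri> _ _ j<i = contradiction (e-inc j i j<i) (<-asym ei<ej)

  strictlyIncreasing⇒injective : Injective _≡_ _≡_ e
  strictlyIncreasing⇒injective {i} {j} ei≡ej with <-cmp i j
  ... | tri< i<j _ _ = contradiction ei≡ej (<⇒≢ (e-inc i j i<j))
  ... | tri≈ _ i≡j _ = i≡j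
  ... | tri> _ _ j<i = contradiction (sym ei≡ej) (<⇒≢ (e-inc j i j<i))

Occurrence-id : ∀ {ρ} → Occurrence ρ ρ id
Occurrence-id = (λ _ _ → id) , λ _ _ → ⇔.refl

Occurrence-∘ : ∀ {σ τ ρ} {e : Fin (size σ) → Fin (size τ)} {f : Fin (size τ) → Fin (size ρ)} →
               Occurrence σ τ e → Occurrence τ ρ f → Occurrence σ ρ (f ∘ e)
Occurrence-∘ {e = e} (e-inc , e-val) (f-inc , f-val) =
  (λ i j → f-inc (e i) (e j) ∘ e-inc i j) , λ i j → ⇔.trans (e-val i j) (f-val (e i) (e j))

Occurrence-resp-≗ : ∀ {τ ρ} {e e′ : Fin (size τ) → Fin (size ρ)} →
                    e ≗ e′ → Occurrence τ ρ e → Occurrence τ ρ e′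
Occurrence-resp-≗ {ρ = ρ} e≗e′ (e-inc , e-val) =
  (λ i j → to (<-cong (e≗e′ i) (e≗e′ j)) ∘ e-inc i j) ,
  λ i j → ⇔.trans (e-val i j) (<-cong (cong (fun ρ) (e≗e′ i)) (cong (fun ρ) (e≗e′ j)))

Occurrence-factor : ∀ {τ σ ρ} {g : Fin (size τ) → Fin (size ρ)} {e : Fin (size σ) → Fin (size ρ)}
                    {h : Fin (size τ) → Fin (size σ)} →
                    Occurrence τ ρ g → Occurrence σ ρ e → (∀ i → e (h i) ≡ g i) → Occurrence τ σ h
Occurrence-factor {ρ = ρ} {h = h} (g-inc , g-val) (e-inc , e-val) e∘h≗g =
  (λ i j i<j → strictlyIncreasing-reflects-< e-inc (from (<-cong (e∘h≗g i) (e∘h≗g j)) (g-inc i j i<j))) ,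
  λ i j → ⇔.trans (g-val i j)
            (⇔.trans (<-cong (cong (fun ρ) (sym (e∘h≗g i))) (cong (fun ρ) (sym (e∘h≗g j))))
                     (⇔.sym (e-val (h i) (h j))))

≼-refl : ∀ {ρ} → ρ ≼ ρ
≼-refl {ρ} = id , Occurrence-id {ρ}

≼-trans : ∀ {σ τ ρ} → σ ≼ τ → τ ≼ ρ → σ ≼ ρ
≼-trans {σ} {τ} {ρ} (e , e-occ) (f , f-occ) = f ∘ e , Occurrence-∘ {σ} {τ} {ρ} e-occ f-occ

record OccursIn (τ ρ : Perm) (S : Fin (size ρ) → Set) : Set where
  constructor occursAt
  field
    positions    : Fin (size τ) → Fin (size ρ)
    isOccurrence : Occurrence τ ρ positions
    within       : ∀ i → S (positions i)

occursIn⇒≼ : ∀ {τ ρ S} → OccursIn τ ρ S → τ ≼ ρ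
occursIn⇒≼ (occursAt e e-occ _) = e , e-occ

≼-occursIn : ∀ {σ τ ρ S} → σ ≼ τ → OccursIn τ ρ S → OccursIn σ ρ S
≼-occursIn {σ} {τ} {ρ} (e , e-occ) (occursAt f f-occ f-in) =
  occursAt (f ∘ e) (Occurrence-∘ {σ} {τ} {ρ} e-occ f-occ) (f-in ∘ e)

pointless-occursIn : ∀ {τ ρ S} → (Fin (size τ) → ⊥) → OccursIn τ ρ S
pointless-occursIn none =
  occursAt (⊥-elim ∘ none) ((λ i → ⊥-elim (none i)) , (λ i → ⊥-elim (none i))) (⊥-elim ∘ none)

∃-fun? : ∀ {m n} {P : (Fin m → Fin n) → Set} →
         (∀ {f g} → f ≗ g → P f → P g) → (∀ f → Dec (P f)) → Dec (∃ P)
∃-fun? resp P? =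
  map′ (λ (i , p) → finToFun i , p) (λ (f , p) → funToFin f , resp (sym ∘ finToFun-funToFin f) p)
       (any? (P? ∘ finToFun))

_⇔?_ : ∀ {A B : Set} → Dec A → Dec B → Dec (A ⇔ B)
A? ⇔? B? = map′ (uncurry mk⇔) (λ A⇔B → to A⇔B , from A⇔B) ((A? →-dec B?) ×-dec (B? →-dec A?))

Occurrence? : ∀ τ ρ e → Dec (Occurrence τ ρ e)
Occurrence? τ ρ e =
  all? (λ i → all? (λ j → (i <? j) →-dec (e i <? e j))) ×-dec
  all? (λ i → all? (λ j → (fun τ i <? fun τ j) ⇔? (fun ρ (e i) <? fun ρ (e j))))

OccursIn? : ∀ τ ρ {S} → Decidable S → Dec (OccursIn τ ρ S)
OccursIn? τ ρ {S} S? =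
  map′ (λ (e , e-occ , e-in) → occursAt e e-occ e-in) (λ (occursAt e e-occ e-in) → e , e-occ , e-in)
    (∃-fun? (λ e≗e′ (e-occ , e-in) →
               Occurrence-resp-≗ {τ} {ρ} e≗e′ e-occ , λ i → subst S (e≗e′ i) (e-in i))
            (λ e → Occurrence? τ ρ e ×-dec all? (S? ∘ e)))

_≼?_ : ∀ τ ρ → Dec (τ ≼ ρ)
τ ≼? ρ = ∃-fun? (Occurrence-resp-≗ {τ} {ρ}) (Occurrence? τ ρ)

punchIn-strictlyIncreasing : ∀ {m} (p : Fin (suc m)) → StrictlyIncreasing (punchIn p)
punchIn-strictlyIncreasing p i j i<j =
  ≤∧≢⇒< (punchIn-mono-≤ p i j (ℕ.<⇒≤ i<j)) (<⇒≢ i<j ∘ punchIn-injective p i j)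

punchOut-<⇔ : ∀ {m} {p x y : Fin (suc m)} (p≢x : p ≢ x) (p≢y : p ≢ y) →
              (punchOut p≢x < punchOut p≢y) ⇔ (x < y)
punchOut-<⇔ {x = x} {y} p≢x p≢y = mk⇔ reflects preserves
  where
  preserves : x < y → punchOut p≢x < punchOut p≢y
  preserves x<y = ≤∧≢⇒< (punchOut-mono-≤ p≢x p≢y (ℕ.<⇒≤ x<y)) (<⇒≢ x<y ∘ punchOut-injective p≢x p≢y)
  reflects : punchOut p≢x < punchOut p≢y → x < y
  reflects px<py with x <? y
  ... | yes x<y = x<y
  ... | no x≮y = contradiction (punchOut-mono-≤ p≢y p≢x (ℕ.≮⇒≥ x≮y)) (ℕ.<⇒≱ px<py)

module _ {m} (f : Fin (suc m) → Fin (suc m)) (f-inj : Injective _≡_ _≡_ f) (p : Fin (suc m)) where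

  private
    avoids : ∀ i → f p ≢ f (punchIn p i)
    avoids i fp≡fi = punchInᵢ≢i p i (f-inj (sym fp≡fi))

  deleteAt : Perm
  deleteAt = perm m (λ i → punchOut (avoids i))
                    (λ eq → punchIn-injective p _ _ (f-inj (punchOut-injective (avoids _) (avoids _) eq)))

  deleteAt-occurrence : Occurrence deleteAt (perm (suc m) f f-inj) (punchIn p)
  deleteAt-occurrence = punchIn-strictlyIncreasing p , λ i j → punchOut-<⇔ (avoids i) (avoids j)

record Restriction (ρ : Perm) (S : Fin (size ρ) → Set) : Set where
  field
    sub        : Perm
    embedding  : Fin (size sub) → Fin (size ρ)
    occurrence : Occurrence sub ρ embedding
    image      : ∀ x → S x ⇔ (Σ[ i ∈ Fin (size sub) ] embedding i ≡ x)

  inside : ∀ i → S (embedding i)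
  inside i = from (image (embedding i)) (i , refl)

  occursIn : OccursIn sub ρ S
  occursIn = occursAt embedding occurrence inside
open Restriction

whole-restriction : ∀ {ρ S} → (∀ x → S x) → Restriction ρ S
whole-restriction {ρ} all-S = record
  { sub = ρ ; embedding = id ; occurrence = Occurrence-id {ρ}
  ; image = λ x → mk⇔ (λ _ → x , refl) (λ _ → all-S x) }

restriction-undelete : ∀ {m} {f : Fin (suc m) → Fin (suc m)} {f-inj : Injective _≡_ _≡_ f} {p}
                       {S : Fin (suc m) → Set} → ¬ S p →
                       Restriction (deleteAt f f-inj p) (S ∘ punchIn p) → Restriction (perm (suc m) f f-inj) S
restriction-undelete {m} {f = f} {f-inj} {p} {S} ¬Sp R = record
  { sub = sub R ; embedding = punchIn p ∘ embedding R
  ; occurrence = Occurrence-∘ {sub R} {deleteAt f f-inj p} {perm (suc m) f f-inj}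
                               (occurrence R) (deleteAt-occurrence f f-inj p)
  ; image = λ x → mk⇔ (hit x) (λ (i , eq) → subst S eq (inside R i)) }
  where
  hit : ∀ x → S x → Σ[ i ∈ Fin (size (sub R)) ] punchIn p (embedding R i) ≡ x
  hit x Sx = proj₁ found , trans (cong (punchIn p) (proj₂ found)) (punchIn-punchOut p≢x)
    where
    p≢x : p ≢ x
    p≢x p≡x = ¬Sp (subst S (sym p≡x) Sx)
    found : Σ[ i ∈ Fin (size (sub R)) ] embedding R i ≡ punchOut p≢x
    found = to (image R (punchOut p≢x)) (subst S (sym (punchIn-punchOut p≢x)) Sx)

restrictPerm : ∀ n (f : Fin n → Fin n) (f-inj : Injective _≡_ _≡_ f) S → Decidable S →
               Restriction (perm n f f-inj) S
restrictPerm n f f-inj S S? with all? S?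
... | yes all-S = whole-restriction all-S
restrictPerm zero f f-inj S S? | no ¬all-S = contradiction (λ ()) ¬all-S
restrictPerm (suc m) f f-inj S S? | no ¬all-S with ¬∀⟶∃¬ (suc m) S S? ¬all-S
... | p , ¬Sp = restriction-undelete ¬Sp (restrictPerm m (fun ρ′) (inj ρ′) (S ∘ punchIn p) (S? ∘ punchIn p))
  where
  ρ′ : Perm
  ρ′ = deleteAt f f-inj p

restrict : ∀ ρ {S} → Decidable S → Restriction ρ S
restrict ρ = restrictPerm (size ρ) (fun ρ) (inj ρ) _

complementary-restrictions-merge : ∀ {ρ S} → Decidable S → (R : Restriction ρ S) (R′ : Restriction ρ (¬_ ∘ S)) →
                                   IsMerge ρ (sub R) (sub R′)
complementary-restrictions-merge {ρ} {S} S? R R′ =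
  embedding R , embedding R′ , occurrence R , occurrence R′ , cover , disjoint
  where
  cover : ∀ x → (Σ[ i ∈ Fin (size (sub R)) ] embedding R i ≡ x) ⊎ (Σ[ j ∈ Fin (size (sub R′)) ] embedding R′ j ≡ x)
  cover x with S? x
  ... | yes Sx = inj₁ (to (image R x) Sx)
  ... | no ¬Sx = inj₂ (to (image R′ x) ¬Sx)
  disjoint : ∀ i j → embedding R i ≢ embedding R′ j
  disjoint i j eq = inside R′ j (subst S eq (inside R i))

ColourClassesIn : (ρ : Perm) {k : ℕ} → (Fin (size ρ) → Fin k) → (Fin k → Class) → Set
ColourClassesIn ρ col D = ∀ c τ → OccursIn τ ρ (λ x → col x ≡ c) → mem (D c) τ

colouring⇒merge : ∀ {k} ρ (col : Fin (size ρ) → Fin (suc k)) (D : Fin (suc k) → Class) →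
                  ColourClassesIn ρ col D → MergeAll (D zero) (tabulate (D ∘ suc)) ρ
colouring⇒merge {zero} ρ col D classes = classes zero ρ (occursAt id (Occurrence-id {ρ}) λ x → only (col x))
  where
  only : (c : Fin 1) → c ≡ zero
  only zero = refl
colouring⇒merge {suc k} ρ col D classes =
  sub Z , sub N , classes zero (sub Z) (occursIn Z) ,
  colouring⇒merge (sub N) col′ (D ∘ suc) classes′ ,
  complementary-restrictions-merge (λ x → col x ≟ zero) Z N
  where
  Z : Restriction ρ (λ x → col x ≡ zero)
  Z = restrict ρ (λ x → col x ≟ zero)
  N : Restriction ρ (λ x → col x ≢ zero)
  N = restrict ρ (λ x → ¬? (col x ≟ zero))
  -- punching out zero is the predecessor on nonzero colours
  col′ : Fin (size (sub N)) → Fin (suc k)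
  col′ i = punchOut (≢-sym (inside N i))
  classes′ : ColourClassesIn (sub N) col′ (D ∘ suc)
  classes′ c τ (occursAt g g-occ g-col) =
    classes (suc c) τ (occursAt (embedding N ∘ g) (Occurrence-∘ {τ} {sub N} {ρ} g-occ (occurrence N))
                       λ i → trans (sym (punchIn-punchOut (≢-sym (inside N (g i))))) (cong suc (g-col i)))

merge⇒colouring : ∀ C Cs π → MergeAll C Cs π →
                  Σ[ col ∈ (Fin (size π) → Fin (suc (length Cs))) ] ColourClassesIn π col (lookup (C ∷ Cs))
merge⇒colouring C [] π π∈C = (λ _ → zero) , λ { zero τ τ-in → closed C π τ π∈C (occursIn⇒≼ τ-in) }
merge⇒colouring C (D ∷ Ds) π (σ , τ , σ∈C , τ∈Ds , e₁ , e₂ , e₁-occ , e₂-occ , cover , _) =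
  col , classes
  where
  τ-colouring : Σ[ col ∈ (Fin (size τ) → Fin (suc (length Ds))) ] ColourClassesIn τ col (lookup (D ∷ Ds))
  τ-colouring = merge⇒colouring D Ds τ τ∈Ds
  Side : Fin (size π) → Set
  Side x = (Σ[ i ∈ Fin (size σ) ] e₁ i ≡ x) ⊎ (Σ[ j ∈ Fin (size τ) ] e₂ j ≡ x)
  colourOf : ∀ {x} → Side x → Fin (suc (suc (length Ds)))
  colourOf (inj₁ _) = zero
  colourOf (inj₂ (j , _)) = suc (proj₁ τ-colouring j)
  col : Fin (size π) → Fin (suc (suc (length Ds)))
  col x = colourOf (cover x)
  first : ∀ {x} (s : Side x) → colourOf s ≡ zero → Σ[ i ∈ Fin (size σ) ] e₁ i ≡ x
  first (inj₁ i) _ = i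
  rest : ∀ {x c} (s : Side x) → colourOf s ≡ suc c →
         Σ[ j ∈ Fin (size τ) ] e₂ j ≡ x × proj₁ τ-colouring j ≡ c
  rest (inj₂ (j , e₂j≡x)) refl = j , e₂j≡x , refl
  classes : ColourClassesIn π col (lookup (C ∷ D ∷ Ds))
  classes zero ρ (occursAt g g-occ g-col) =
    closed C σ ρ σ∈C
      (_ , Occurrence-factor {ρ} {σ} {π} g-occ e₁-occ (λ i → proj₂ (first (cover (g i)) (g-col i))))
  classes (suc c) ρ (occursAt g g-occ g-col) =
    proj₂ τ-colouring c ρ
      (occursAt (proj₁ ∘ position)
                (Occurrence-factor {ρ} {τ} {π} g-occ e₂-occ (proj₁ ∘ proj₂ ∘ position))
                (proj₂ ∘ proj₂ ∘ position))
    where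
    position : ∀ i → Σ[ j ∈ Fin (size τ) ] e₂ j ≡ g i × proj₁ τ-colouring j ≡ c
    position i = rest (cover (g i)) (g-col i)

Av : Class → Perm → Class
Av C σ = record
  { mem = λ ρ → mem C ρ × ¬ σ ≼ ρ
  ; closed = λ ρ τ (ρ∈C , σ⋠ρ) τ≼ρ →
               closed C ρ τ ρ∈C τ≼ρ , λ σ≼τ → σ⋠ρ (≼-trans {σ} {τ} {ρ} σ≼τ τ≼ρ) }

Av-proper : ∀ C {σ} → mem C σ → ProperSubclass (Av C σ) (mem C)
Av-proper C {σ} σ∈C = (λ _ → proj₁) , σ , σ∈C , λ (_ , σ⋠σ) → σ⋠σ (≼-refl {σ})

Arrows : (ρ : Perm) {k : ℕ} → (Fin k → Perm) → Set
Arrows ρ {k} σ = (col : Fin (size ρ) → Fin k) → Σ[ c ∈ Fin k ] OccursIn (σ c) ρ (λ x → col x ≡ c)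

unsplittable⇒arrows : ∀ C → Unsplittable (mem C) → ∀ {k} (σ : Fin (suc k) → Perm) → (∀ c → mem C (σ c)) →
                      ¬ ¬ (Σ[ ρ ∈ Perm ] mem C ρ × Arrows ρ σ)
unsplittable⇒arrows C unsplittable {k} σ σ∈C noArrowing =
  unsplittable ( Av C (σ zero) , tabulate (Av C ∘ σ ∘ suc)
               , Av-proper C (σ∈C zero) , All.tabulate⁺ (Av-proper C ∘ σ∈C ∘ suc) , covered )
  where
  Avoiding : ∀ ρ → (Fin (size ρ) → Fin (suc k)) → Set
  Avoiding ρ col = ∀ c → ¬ OccursIn (σ c) ρ (λ x → col x ≡ c)

  occurs? : ∀ ρ col c → Dec (OccursIn (σ c) ρ (λ x → col x ≡ c))
  occurs? ρ col c = OccursIn? (σ c) ρ (λ x → col x ≟ c)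

  avoiding? : ∀ ρ → Dec (∃ (Avoiding ρ))
  avoiding? ρ =
    ∃-fun? (λ col≗col′ avoids c (occursAt e e-occ e-col) →
              avoids c (occursAt e e-occ λ i → trans (col≗col′ (e i)) (e-col i)))
           (λ col → all? (λ c → ¬? (occurs? ρ col c)))

  covered : mem C ⊆ MergeAll (Av C (σ zero)) (tabulate (Av C ∘ σ ∘ suc))
  covered ρ ρ∈C with avoiding? ρ
  ... | yes (col , avoids) =
    colouring⇒merge ρ col (Av C ∘ σ) λ c τ τ-in →
      closed C ρ τ ρ∈C (occursIn⇒≼ τ-in) , λ σ≼τ → avoids c (≼-occursIn σ≼τ τ-in)
  ... | no ¬avoiding = contradiction (ρ , ρ∈C , arrows) noArrowing
    where
    arrows : Arrows ρ σ
    arrows col with ¬∀⟶∃¬ (suc k) _ (λ c → ¬? (occurs? ρ col c)) (λ avoids → ¬avoiding (col , avoids))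
    ... | c , ¬¬occurs = c , decidable-stable (occurs? ρ col c) ¬¬occurs

ε : Perm
ε = perm zero (λ ()) (λ { {()} })

ε-≼ : ∀ {ρ} → ε ≼ ρ
ε-≼ = (λ ()) , (λ ()) , (λ ())

merge-εʳ : ∀ ρ → IsMerge ρ ρ ε
merge-εʳ ρ = id , (λ ()) , Occurrence-id {ρ} , ((λ ()) , (λ ())) , (λ x → inj₁ (x , refl)) , λ _ ()

merge-εˡ : ∀ ρ → IsMerge ρ ε ρ
merge-εˡ ρ = (λ ()) , id , ((λ ()) , (λ ())) , Occurrence-id {ρ} , (λ x → inj₂ (x , refl)) , λ ()

unsplittable⇒jointEmbedding : ∀ C → Unsplittable (mem C) → ∀ {ρ₁ ρ₂} → mem C ρ₁ → mem C ρ₂ →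
                              ¬ ¬ (Σ[ ρ ∈ Perm ] mem C ρ × ρ₁ ≼ ρ × ρ₂ ≼ ρ)
unsplittable⇒jointEmbedding C unsplittable {ρ₁} {ρ₂} ρ₁∈C ρ₂∈C noBound =
  unsplittable (Av C ρ₁ , Av C ρ₂ ∷ [] , Av-proper C ρ₁∈C , Av-proper C ρ₂∈C All.∷ All.[] , covered)
  where
  covered : mem C ⊆ MergeAll (Av C ρ₁) (Av C ρ₂ ∷ [])
  covered ρ ρ∈C with ρ₁ ≼? ρ | ρ₂ ≼? ρ
  ... | yes ρ₁≼ρ | yes ρ₂≼ρ = contradiction (ρ , ρ∈C , ρ₁≼ρ , ρ₂≼ρ) noBound
  ... | no ρ₁⋠ρ | _ =
    ρ , ε , (ρ∈C , ρ₁⋠ρ) ,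
    (closed C ρ ε ρ∈C (ε-≼ {ρ}) ,
     λ ρ₂≼ε → noBound (ρ₁ , ρ₁∈C , ≼-refl {ρ₁} , ≼-trans {ρ₂} {ε} {ρ₁} ρ₂≼ε (ε-≼ {ρ₁}))) ,
    merge-εʳ ρ
  ... | yes _ | no ρ₂⋠ρ =
    ε , ρ ,
    (closed C ρ ε ρ∈C (ε-≼ {ρ}) ,
     λ ρ₁≼ε → noBound (ρ₂ , ρ₂∈C , ≼-trans {ρ₁} {ε} {ρ₂} ρ₁≼ε (ε-≼ {ρ₂}) , ≼-refl {ρ₂})) ,
    (ρ∈C , ρ₂⋠ρ) , merge-εˡ ρ

unsplittable⇒upperBound : ∀ C → Unsplittable (mem C) → ∀ {n} (t : Fin n → Perm) → (∀ i → mem C (t i)) →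
                          ∀ {υ} → mem C υ → ¬ ¬ (Σ[ ρ ∈ Perm ] mem C ρ × υ ≼ ρ × ∀ i → t i ≼ ρ)
unsplittable⇒upperBound C unsplittable {zero} t _ {υ} υ∈C = pure (υ , υ∈C , ≼-refl {υ} , λ ())
unsplittable⇒upperBound C unsplittable {suc n} t t∈C {υ} υ∈C = do
  (ρ₁ , ρ₁∈C , υ≼ρ₁ , t₀≼ρ₁) ← unsplittable⇒jointEmbedding C unsplittable υ∈C (t∈C zero)
  (ρ , ρ∈C , ρ₁≼ρ , t≼ρ) ← unsplittable⇒upperBound C unsplittable (t ∘ suc) (t∈C ∘ suc) ρ₁∈C
  pure ( ρ , ρ∈C , ≼-trans {υ} {ρ₁} {ρ} υ≼ρ₁ ρ₁≼ρ
       , λ { zero → ≼-trans {t zero} {ρ₁} {ρ} t₀≼ρ₁ ρ₁≼ρ ; (suc i) → t≼ρ i } )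

¬¬-∀-Fin : ∀ {n} {P : Fin n → Set} → (∀ i → ¬ ¬ P i) → ¬ ¬ (∀ i → P i)
¬¬-∀-Fin {zero} _ = pure (λ ())
¬¬-∀-Fin {suc n} ¬¬P = do
  p₀ ← ¬¬P zero
  p ← ¬¬-∀-Fin (¬¬P ∘ suc)
  pure λ { zero → p₀ ; (suc i) → p i }

module _ {m n : ℕ} where

  combine-<-sameRow : ∀ (x : Fin m) (y y′ : Fin n) → (combine x y < combine x y′) ⇔ (y < y′)
  combine-<-sameRow x y y′ rewrite toℕ-combine x y | toℕ-combine x y′ =
    mk⇔ (ℕ.+-cancelˡ-< (n ℕ.* toℕ x) _ _) (ℕ.+-monoʳ-< (n ℕ.* toℕ x))

  combine-<-otherRow : ∀ {x x′ : Fin m} (y y′ : Fin n) → x ≢ x′ → (combine x y < combine x′ y′) ⇔ (x < x′)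
  combine-<-otherRow {x} {x′} y y′ x≢x′ = mk⇔ reflects (combine-monoˡ-< y y′)
    where
    reflects : combine x y < combine x′ y′ → x < x′
    reflects cxy<cx′y′ with <-cmp x x′
    ... | tri< x<x′ _ _ = x<x′
    ... | tri≈ _ x≡x′ _ = contradiction x≡x′ x≢x′
    ... | tri> _ _ x′<x = contradiction (combine-monoˡ-< y′ y x′<x) (<-asym cxy<cx′y′)

  quotient-mono-≤ : ∀ {z z′ : Fin (m ℕ.* n)} → z ≤ z′ → quotient {m} n z ≤ quotient {m} n z′
  quotient-mono-≤ {z} {z′} z≤z′ with quotient {m} n z′ <? quotient {m} n z
  ... | no q′≮q = ℕ.≮⇒≥ q′≮q
  ... | yes q′<q = contradiction z≤z′ (ℕ.<⇒≱ (subst₂ _<_ (combine-remQuot {m} n z′) (combine-remQuot {m} n z)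
                                               (combine-monoˡ-< (remainder {m} n z′) (remainder {m} n z) q′<q)))

infixl 7 _⊗_

_⊗_ : Perm → Perm → Perm
ρ ⊗ ρ′ = perm (size ρ ℕ.* size ρ′) value value-injective
  where
  row : Fin (size ρ ℕ.* size ρ′) → Fin (size ρ)
  row = quotient (size ρ′)
  column : Fin (size ρ ℕ.* size ρ′) → Fin (size ρ′)
  column = remainder {size ρ} (size ρ′)
  value : Fin (size ρ ℕ.* size ρ′) → Fin (size ρ ℕ.* size ρ′)
  value z = combine (fun ρ (row z)) (fun ρ′ (column z))
  value-injective : Injective _≡_ _≡_ value
  value-injective {z} {z′} vz≡vz′ with combine-injective _ _ _ _ vz≡vz′
  ... | q≡q′ , r≡r′ = begin
    z                           ≡⟨ combine-remQuot {size ρ} (size ρ′) z ⟨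
    combine (row z) (column z)   ≡⟨ cong₂ combine (inj ρ q≡q′) (inj ρ′ r≡r′) ⟩
    combine (row z′) (column z′) ≡⟨ combine-remQuot {size ρ} (size ρ′) z′ ⟩
    z′                           ∎
    where open ≡-Reasoning

module _ (ρ ρ′ : Perm) where

  ⊗-value : ∀ x y → fun (ρ ⊗ ρ′) (combine x y) ≡ combine (fun ρ x) (fun ρ′ y)
  ⊗-value x y = cong (λ (a , b) → combine (fun ρ a) (fun ρ′ b)) (remQuot-combine {size ρ} {size ρ′} x y)

  ⊗-<-sameRow : ∀ x y y′ →
                (fun (ρ ⊗ ρ′) (combine x y) < fun (ρ ⊗ ρ′) (combine x y′)) ⇔ (fun ρ′ y < fun ρ′ y′)
  ⊗-<-sameRow x y y′ = ⇔.trans (<-cong (⊗-value x y) (⊗-value x y′)) (combine-<-sameRow (fun ρ x) _ _)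

  ⊗-<-otherRow : ∀ {x x′} y y′ → x ≢ x′ →
                 (fun (ρ ⊗ ρ′) (combine x y) < fun (ρ ⊗ ρ′) (combine x′ y′)) ⇔ (fun ρ x < fun ρ x′)
  ⊗-<-otherRow y y′ x≢x′ =
    ⇔.trans (<-cong (⊗-value _ y) (⊗-value _ y′)) (combine-<-otherRow _ _ (x≢x′ ∘ inj ρ))

  ⊗-isInflation : IsInflation (ρ ⊗ ρ′) ρ (λ _ → ρ′)
  ⊗-isInflation =
    row , (λ _ _ → quotient-mono-≤) , (λ _ _ row≢row′ → combine-<-otherRow _ _ (row≢row′ ∘ inj ρ)) ,
    λ a → combine a , rowOccurrence a , rowImage a
    where
    row : Fin (size ρ ℕ.* size ρ′) → Fin (size ρ)
    row = quotient (size ρ′)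
    column : Fin (size ρ ℕ.* size ρ′) → Fin (size ρ′)
    column = remainder {size ρ} (size ρ′)
    rowOccurrence : ∀ a → Occurrence ρ′ (ρ ⊗ ρ′) (combine a)
    rowOccurrence a = (λ y y′ → from (combine-<-sameRow a y y′)) , λ y y′ → ⇔.sym (⊗-<-sameRow a y y′)
    rowImage : ∀ a z → (row z ≡ a) ⇔ (Σ[ y ∈ Fin (size ρ′) ] combine a y ≡ z)
    rowImage a z =
      mk⇔ (λ row≡a → column z , trans (cong (λ b → combine b (column z)) (sym row≡a)) (combine-remQuot {size ρ} _ z))
          (λ (y , a∘y≡z) → subst (λ w → row w ≡ a) a∘y≡z (cong proj₁ (remQuot-combine {size ρ} {size ρ′} a y)))

module _ {π σ : Perm} {τ : Fin (size σ) → Perm} (infl : IsInflation π σ τ)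
         {ρ ρ′ : Perm} {f : Fin (size σ) → Fin (size ρ)} (f-occ : Occurrence σ ρ f)
         {S : Fin (size (ρ ⊗ ρ′)) → Set} (blocks-in : ∀ a → OccursIn (τ a) ρ′ (λ y → S (combine (f a) y)))
         where

  private
    block : Fin (size π) → Fin (size σ)
    block = proj₁ infl
    block-mono : ∀ p q → p ≤ q → block p ≤ block q
    block-mono = proj₁ (proj₂ infl)
    block-values : ∀ p q → block p ≢ block q → (fun π p < fun π q) ⇔ (fun σ (block p) < fun σ (block q))
    block-values = proj₁ (proj₂ (proj₂ infl))
    e : ∀ a → Fin (size (τ a)) → Fin (size π)
    e a = proj₁ (proj₂ (proj₂ (proj₂ infl)) a)
    e-occ : ∀ a → Occurrence (τ a) π (e a)
    e-occ a = proj₁ (proj₂ (proj₂ (proj₂ (proj₂ infl)) a))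
    e-image : ∀ a p → (block p ≡ a) ⇔ (Σ[ i ∈ Fin (size (τ a)) ] e a i ≡ p)
    e-image a = proj₂ (proj₂ (proj₂ (proj₂ (proj₂ infl)) a))
    G : ∀ a → Fin (size (τ a)) → Fin (size ρ′)
    G a = OccursIn.positions (blocks-in a)
    G-occ : ∀ a → Occurrence (τ a) ρ′ (G a)
    G-occ a = OccursIn.isOccurrence (blocks-in a)
    G-in : ∀ a j → S (combine (f a) (G a j))
    G-in a = OccursIn.within (blocks-in a)

    indexIn : ∀ {a p} → block p ≡ a → Fin (size (τ a))
    indexIn {a} {p} bp≡a = proj₁ (to (e-image a p) bp≡a)

    indexIn-correct : ∀ {a p} (bp≡a : block p ≡ a) → e a (indexIn bp≡a) ≡ p
    indexIn-correct {a} {p} bp≡a = proj₂ (to (e-image a p) bp≡a)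

    placeIn : ∀ {a p} → block p ≡ a → Fin (size (ρ ⊗ ρ′))
    placeIn {a} bp≡a = combine (f a) (G a (indexIn bp≡a))

    h : Fin (size π) → Fin (size (ρ ⊗ ρ′))
    h p = placeIn {block p} refl

    h-placeIn : ∀ {a p} (bp≡a : block p ≡ a) → h p ≡ placeIn bp≡a
    h-placeIn refl = refl

    sameBlock-< : ∀ {a p q} (bp≡a : block p ≡ a) (bq≡a : block q ≡ a) → p < q → placeIn bp≡a < placeIn bq≡a
    sameBlock-< {a} bp≡a bq≡a p<q =
      from (combine-<-sameRow (f a) _ _)
        (proj₁ (G-occ a) _ _ (strictlyIncreasing-reflects-< (proj₁ (e-occ a))
          (from (<-cong (indexIn-correct bp≡a) (indexIn-correct bq≡a)) p<q)))

    sameBlock-values : ∀ {a p q} (bp≡a : block p ≡ a) (bq≡a : block q ≡ a) →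
                       (fun π p < fun π q) ⇔ (fun (ρ ⊗ ρ′) (placeIn bp≡a) < fun (ρ ⊗ ρ′) (placeIn bq≡a))
    sameBlock-values {a} {p} {q} bp≡a bq≡a = begin
      fun π p < fun π q
        ≈⟨ <-cong (cong (fun π) (indexIn-correct bp≡a)) (cong (fun π) (indexIn-correct bq≡a)) ⟨
      fun π (e a i) < fun π (e a j)
        ≈⟨ proj₂ (e-occ a) i j ⟨
      fun (τ a) i < fun (τ a) j
        ≈⟨ proj₂ (G-occ a) i j ⟩
      fun ρ′ (G a i) < fun ρ′ (G a j)
        ≈⟨ ⊗-<-sameRow ρ ρ′ (f a) (G a i) (G a j) ⟨
      fun (ρ ⊗ ρ′) (combine (f a) (G a i)) < fun (ρ ⊗ ρ′) (combine (f a) (G a j))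
        ∎
      where
      open ⇔-Reasoning
      i j : Fin (size (τ a))
      i = indexIn bp≡a
      j = indexIn bq≡a

    h-inc : StrictlyIncreasing h
    h-inc p q p<q with block p ≟ block q
    ... | yes bp≡bq = subst (_< h q) (sym (h-placeIn bp≡bq)) (sameBlock-< bp≡bq refl p<q)
    ... | no bp≢bq = combine-monoˡ-< _ _ (proj₁ f-occ _ _ (≤∧≢⇒< (block-mono p q (ℕ.<⇒≤ p<q)) bp≢bq))

    h-values : ∀ p q → (fun π p < fun π q) ⇔ (fun (ρ ⊗ ρ′) (h p) < fun (ρ ⊗ ρ′) (h q))
    h-values p q with block p ≟ block q
    ... | yes bp≡bq =
      ⇔.trans (sameBlock-values bp≡bq refl) (<-cong (cong (fun (ρ ⊗ ρ′)) (sym (h-placeIn bp≡bq))) refl)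
    ... | no bp≢bq = begin
      fun π p < fun π q
        ≈⟨ block-values p q bp≢bq ⟩
      fun σ (block p) < fun σ (block q)
        ≈⟨ proj₂ f-occ _ _ ⟩
      fun ρ (f (block p)) < fun ρ (f (block q))
        ≈⟨ ⊗-<-otherRow ρ ρ′ _ _ (bp≢bq ∘ strictlyIncreasing⇒injective (proj₁ f-occ)) ⟨
      fun (ρ ⊗ ρ′) (h p) < fun (ρ ⊗ ρ′) (h q)
        ∎
      where open ⇔-Reasoning

  inflation-occursIn-⊗ : OccursIn π (ρ ⊗ ρ′) S
  inflation-occursIn-⊗ = occursAt h (h-inc , h-values) λ p → G-in (block p) (indexIn refl)

⊗-arrows : ∀ {k} {π σ τ* : Fin k → Perm} {τ : ∀ c → Fin (size (σ c)) → Perm} {ρ ρ′} →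
           (∀ c → IsInflation (π c) (σ c) (τ c)) → (∀ c a → τ c a ≼ τ* c) →
           Arrows ρ σ → Arrows ρ′ τ* → Arrows (ρ ⊗ ρ′) π
⊗-arrows {k} {π} {σ} {τ*} {τ} {ρ} {ρ′} infl τ≼τ* ρ→σ ρ′→τ* col =
  c , inflation-occursIn-⊗ {π c} {σ c} {τ c} (infl c) {ρ} {ρ′} f-occ {λ z → col z ≡ c}
        λ a → ≼-occursIn (τ≼τ* c a) (rowOccurrence (f a) (f-colour a))
  where
  rowColour : Fin (size ρ) → Fin k
  rowColour x = proj₁ (ρ′→τ* (λ y → col (combine x y)))
  rowOccurrence : ∀ x {d} → rowColour x ≡ d → OccursIn (τ* d) ρ′ (λ y → col (combine x y) ≡ d)
  rowOccurrence x refl = proj₂ (ρ′→τ* (λ y → col (combine x y)))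
  c : Fin k
  c = proj₁ (ρ→σ rowColour)
  open OccursIn (proj₂ (ρ→σ rowColour)) renaming (positions to f; isOccurrence to f-occ; within to f-colour)

inflations-arrows : ∀ X Y → Unsplittable (mem X) → Unsplittable (mem Y) → ∀ {υ} → mem Y υ →
                    ∀ {k} {π : Fin (suc k) → Perm} → (∀ c → Inflations X Y (π c)) →
                    ¬ ¬ (Σ[ ρ ∈ Perm ] Inflations X Y ρ × Arrows ρ π)
inflations-arrows X Y X-unsplittable Y-unsplittable υ∈Y {k} {π} π∈XY = do
  bounds ← ¬¬-∀-Fin λ c → unsplittable⇒upperBound Y Y-unsplittable (τ c) (τ∈Y c) υ∈Y
  let τ* = λ c → proj₁ (bounds c)
  (ρ , ρ∈X , ρ→σ) ← unsplittable⇒arrows X X-unsplittable σ σ∈X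
  (ρ′ , ρ′∈Y , ρ′→τ*) ← unsplittable⇒arrows Y Y-unsplittable τ* (λ c → proj₁ (proj₂ (bounds c)))
  pure ( ρ ⊗ ρ′ , (ρ , (λ _ → ρ′) , ρ∈X , (λ _ → ρ′∈Y) , ⊗-isInflation ρ ρ′)
       , ⊗-arrows {σ = σ} {τ*} {τ} {ρ} {ρ′} infl (λ c → proj₂ (proj₂ (proj₂ (bounds c)))) ρ→σ ρ′→τ* )
  where
  σ : Fin (suc k) → Perm
  σ c = proj₁ (π∈XY c)
  τ : ∀ c → Fin (size (σ c)) → Perm
  τ c = proj₁ (proj₂ (π∈XY c))
  σ∈X : ∀ c → mem X (σ c)
  σ∈X c = proj₁ (proj₂ (proj₂ (π∈XY c)))
  τ∈Y : ∀ c a → mem Y (τ c a)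
  τ∈Y c = proj₁ (proj₂ (proj₂ (proj₂ (π∈XY c))))
  infl : ∀ c → IsInflation (π c) (σ c) (τ c)
  infl c = proj₂ (proj₂ (proj₂ (proj₂ (π∈XY c))))

Fin? : ∀ n → Dec (Fin n)
Fin? zero = no λ ()
Fin? (suc n) = yes zero

inflation-inhabits⊎pointless : ∀ {X Y π} → Inflations X Y π → Σ Perm (mem Y) ⊎ (Fin (size π) → ⊥)
inflation-inhabits⊎pointless (σ , τ , _ , τ∈Y , infl) with Fin? (size σ)
... | yes a = inj₁ (τ a , τ∈Y a)
... | no σ-empty = inj₂ (σ-empty ∘ proj₁ infl)

pointless-mergeAll : ∀ C Cs {π} → MergeAll C Cs π → (Fin (size π) → ⊥) → mem C π
pointless-mergeAll C Cs {π} π∈merge none = proj₂ (merge⇒colouring C Cs π π∈merge) zero π (pointless-occursIn none)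

covered⇒¬arrows : ∀ {P : PermSet} C Cs → P ⊆ MergeAll C Cs → {π : Fin (suc (length Cs)) → Perm} →
                  (∀ c → ¬ mem (lookup (C ∷ Cs) c) (π c)) → ¬ (Σ[ ρ ∈ Perm ] P ρ × Arrows ρ π)
covered⇒¬arrows C Cs covered {π} π∉C (ρ , ρ∈P , ρ→π) with merge⇒colouring C Cs ρ (covered ρ ρ∈P)
... | col , classes with ρ→π col
... | c , π-in = π∉C c (classes c (π c) π-in)

mainTheorem8 : (X Y : Class) → Unsplittable (mem X) → Unsplittable (mem Y) → Unsplittable (Inflations X Y)
mainTheorem8 X Y X-unsplittable Y-unsplittable (C , Cs , C-proper , Cs-proper , covered) =
  [ (λ (υ , υ∈Y) → inflations-arrows X Y X-unsplittable Y-unsplittable υ∈Y π∈XY (covered⇒¬arrows C Cs covered π∉C))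
  , (λ none → π∉C zero (pointless-mergeAll C Cs (covered (π zero) (π∈XY zero)) none))
  ]′ (inflation-inhabits⊎pointless {X} {Y} {π zero} (π∈XY zero))
  where
  witness : ∀ c → Σ[ π ∈ Perm ] Inflations X Y π × ¬ mem (lookup (C ∷ Cs) c) π
  witness c = proj₂ (All.lookup (C-proper All.∷ Cs-proper) (∈-lookup c))
  π : Fin (suc (length Cs)) → Perm
  π c = proj₁ (witness c)
  π∈XY : ∀ c → Inflations X Y (π c)
  π∈XY c = proj₁ (proj₂ (witness c))
  π∉C : ∀ c → ¬ mem (lookup (C ∷ Cs) c) (π c)
  π∉C c = proj₂ (proj₂ (witness c))
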